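{- For every integer $N$ there exists a connected chordal graph $G$ with $\gamma_b(G)-\mathrm{mp}(G)\ge N$; that is, the difference $\gamma_b(G)-\mathrm{mp}(G)$ is unbounded over connected chordal graphs.
   Context: All graphs are finite, simple and undirected; $d(u,v)$ is the shortest-path distance and $\mathrm{diam}(G)$ the diameter. A graph is chordal if every cycle on four or more vertices has a chord. For $v\in V(G)$ and integer $r\ge 0$, $N_r[v]=\{u\in V(G): d(u,v)\le r\}$. A broadcast on $G$ is a function $f:V(G)\to\{0,1,\dots,\mathrm{diam}(G)\}$; it is dominating if for every $u\in V(G)$ there is $v$ (possibly $v=u$) with $f(v)>0$ and $d(u,v)\le f(v)$. Its cost is $\sum_{v} f(v)$, and $\gamma_b(G)$ is the minimum cost of a dominating broadcast. A multipacking is a set $M\subseteq V(G)$ with $|N_r[v]\cap M|\le r$ for every $v\in V(G)$ and every integer $r\ge 1$; $\mathrm{mp}(G)$ is the maximum size of a multipacking. -}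

module Defs where

open import Data.Nat using (ℕ; zero; suc; _+_; _≤_; _<_; _%_)
open import Data.Nat.DivMod using (m%n<n)
open import Data.Bool using (Bool; true; false; _∧_; _∨_; if_then_else_)
open import Data.Fin using (Fin; toℕ; fromℕ<; _≟_)
open import Data.List using (List; map; allFin)
open import Data.Nat.ListAction using (sum)
open import Data.Bool.ListAction using (any)
open import Data.Product using (Σ; _×_; ∃; ∃-syntax)
open import Relation.Nullary using (¬_)
open import Relation.Nullary.Decidable using (⌊_⌋)
open import Relation.Binary.PropositionalEquality using (_≡_; _≢_)
open import Function using (Injective)

record Graph : Set where
  field
    n     : ℕ
    Adj   : Fin n → Fin n → Bool
    sym   : ∀ u v → Adj u v ≡ Adj v u
    irref : ∀ v → Adj v v ≡ false
open Graph public

-- Closed ball N_r[v] as a Boolean predicate: ball G v r u = true  iff  d(u,v) ≤ r.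
-- N_0[v] = {v};  N_{r+1}[v] = N_r[v] ∪ { u : u adjacent to some w ∈ N_r[v] }.
ball : (G : Graph) → Fin (n G) → ℕ → Fin (n G) → Bool
ball G v zero    u = ⌊ u ≟ v ⌋
ball G v (suc r) u = ball G v r u ∨ any (λ w → ball G v r w ∧ Adj G w u) (allFin (n G))

_⊢_≤dist_ : (G : Graph) → Fin (n G) → Fin (n G) → ℕ → Set
G ⊢ u ≤dist v = λ r → ball G v r u ≡ true

Connected : Graph → Set
Connected G = (0 < n G) × (∀ u v → Σ ℕ λ r → ball G v r u ≡ true)

IsDiam : Graph → ℕ → Set
IsDiam G D = (∀ u v → ball G v D u ≡ true)
           × (∀ D' → (∀ u v → ball G v D' u ≡ true) → D ≤ D')

cnext : ∀ {k} → Fin (suc k) → Fin (suc k)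
cnext {k} i = fromℕ< (m%n<n (suc (toℕ i)) (suc k))

record Cycle (G : Graph) (m : ℕ) : Set where
  field
    c     : Fin (suc (suc (suc (suc m)))) → Fin (n G)
    inj   : Injective _≡_ _≡_ c
    edges : ∀ i → Adj G (c i) (c (cnext i)) ≡ true
open Cycle public

HasChord : (G : Graph) {m : ℕ} → Cycle G m → Set
HasChord G C = ∃[ i ] ∃[ j ] (Adj G (c C i) (c C j) ≡ true × j ≢ cnext i × i ≢ cnext j)

Chordal : Graph → Set
Chordal G = ∀ m (C : Cycle G m) → HasChord G C

Σv : (G : Graph) → (Fin (n G) → ℕ) → ℕ
Σv G f = sum (map f (allFin (n G)))

IsBroadcast : (G : Graph) → (Fin (n G) → ℕ) → Set
IsBroadcast G f = ∀ D → IsDiam G D → ∀ v → f v ≤ D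

Dominating : (G : Graph) → (Fin (n G) → ℕ) → Set
Dominating G f = ∀ u → ∃[ v ] (0 < f v × ball G v (f v) u ≡ true)

cost : (G : Graph) → (Fin (n G) → ℕ) → ℕ
cost G f = Σv G f

IsBroadcastDomNumber : Graph → ℕ → Set
IsBroadcastDomNumber G g =
  (∃[ f ] (IsBroadcast G f × Dominating G f × cost G f ≡ g))
  × (∀ f → IsBroadcast G f → Dominating G f → g ≤ cost G f)

card : (G : Graph) → (Fin (n G) → Bool) → ℕ
card G S = Σv G (λ u → if S u then 1 else 0)

IsMultipacking : (G : Graph) → (Fin (n G) → Bool) → Set
IsMultipacking G M = ∀ v r → 1 ≤ r → card G (λ u → ball G v r u ∧ M u) ≤ r

IsMultipackingNumber : Graph → ℕ → Set
IsMultipackingNumber G p =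
  (∃[ M ] (IsMultipacking G M × card G M ≡ p))
  × (∀ M → IsMultipacking G M → card G M ≤ p)

module Submission where

-- The witness is a chain of S = 6(N + 1) suns: triangles 2 3 4 with ears 0, 1, 5 on their sides, ear 5 of
-- each sun joined to ear 0 of the next.  Numbering the vertices along the chain gives a perfect elimination
-- order, so the chain is chordal.  Any two vertices of a sun have a common closed neighbour, so a multipacking
-- meets each sun at most once and mp ≤ S.  For γ_b, weight 7 of the 9 ears of every three consecutive suns.
-- A closed neighbourhood contains at most two weighted vertices.  The ears carry distinct levels, the level
-- changes by at most one along an edge, and five consecutive levels carry at most four weighted ears, so a
-- ball of radius r ≥ 2 contains at most 2r weighted vertices.  Every weighted vertex is dominated, hence
-- 2 γ_b ≥ 7S/3 and γ_b − mp ≥ S/6 = N + 1.  All local facts about the chain are periodic in the vertex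
-- index and are proved by evaluating a Boolean check on one period.

open import Defs hiding (sym)
open import Data.Bool using (Bool; true; false; _∧_; _∨_; not; if_then_else_; T)
import Data.Bool.Properties as Bool
open import Data.Empty using (⊥-elim)
open import Data.Fin using (Fin; zero; suc; toℕ; fromℕ<; fromℕ; _≟_)
open import Data.Fin.Properties using (toℕ<n; toℕ-fromℕ<; fromℕ<-toℕ; toℕ-fromℕ; toℕ-injective; any?; all?)
open import Data.List using (map; allFin)
open import Data.List.Extrema.Nat using (argmin; f[argmin]≤f[xs])
open import Data.List.Membership.Propositional using (lose)
open import Data.List.Membership.Propositional.Properties using (∈-allFin)
open import Data.List.Properties using (map-tabulate)
import Data.List.Relation.Unary.All as All
open import Data.List.Relation.Unary.Any using (satisfied)
open import Data.List.Relation.Unary.Any.Properties using (any⁺; any⁻)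
open import Data.Nat
  using (ℕ; zero; suc; _+_; _*_; _∸_; _%_; _≤_; _<_; z≤n; s≤s; s≤s⁻¹; z<s; _<ᵇ_; _≤ᵇ_; _≡ᵇ_; _≤?_; _<?_)
  using (NonZero; >-nonZero⁻¹)
open import Data.Nat.DivMod using (m<n⇒m%n≡m; m%n%n≡m%n; %-distribˡ-+; [m+n]%n≡m%n; m≤n⇒[n∸m]%m≡n%m)
open import Data.Nat.Induction using (<-rec)
open import Data.Nat.ListAction using (sum)
open import Data.Nat.Properties hiding (_≟_)
open import Data.Nat.Tactic.RingSolver using (solve-∀)
open import Data.Product using (Σ; ∃; ∃-syntax; _×_; _,_; proj₁; proj₂)
open import Data.Sum using (_⊎_; inj₁; inj₂)
import Data.Sum as Sum
open import Data.Unit using (tt)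
open import Data.Vec.Functional using (_∷_; head; tail)
open import Function using (id; _∘_; _∘′_; case_of_)
open import Relation.Nullary using (¬_; Dec; yes; no; contradiction)
open import Relation.Nullary.Decidable using (_×-dec_; _→-dec_; map′; fromWitness; toWitness)
open import Relation.Binary.PropositionalEquality

∧-true⁻ : ∀ {x y} → x ∧ y ≡ true → x ≡ true × y ≡ true
∧-true⁻ {true} p = refl , p

∧-true⁺ : ∀ {x y} → x ≡ true → y ≡ true → x ∧ y ≡ true
∧-true⁺ refl refl = refl

∨-true⁻ : ∀ {x y} → x ∨ y ≡ true → x ≡ true ⊎ y ≡ true
∨-true⁻ {true}  _ = inj₁ refl
∨-true⁻ {false} p = inj₂ p

_⇒ᵇ_ : Bool → Bool → Bool
x ⇒ᵇ y = not x ∨ y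

⇒ᵇ-mp : ∀ {x y} → x ⇒ᵇ y ≡ true → x ≡ true → y ≡ true
⇒ᵇ-mp p refl = p

T⇒≡true : ∀ {x} → T x → x ≡ true
T⇒≡true {true} _ = refl

≡true⇒T : ∀ {x} → x ≡ true → T x
≡true⇒T refl = tt

≡ᵇ-true⇒≡ : ∀ {m n} → (m ≡ᵇ n) ≡ true → m ≡ n
≡ᵇ-true⇒≡ {m} {n} = ≡ᵇ⇒≡ m n ∘ ≡true⇒T

<ᵇ-true⇒< : ∀ {m n} → (m <ᵇ n) ≡ true → m < n
<ᵇ-true⇒< {m} {n} = <ᵇ⇒< m n ∘ ≡true⇒T

≤ᵇ-true⇒≤ : ∀ {m n} → (m ≤ᵇ n) ≡ true → m ≤ n
≤ᵇ-true⇒≤ {m} {n} = ≤ᵇ⇒≤ m n ∘ ≡true⇒T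

<ᵇ-irrefl : ∀ a → (a <ᵇ a) ≡ false
<ᵇ-irrefl zero    = refl
<ᵇ-irrefl (suc a) = <ᵇ-irrefl a

ind : Bool → ℕ
ind b = if b then 1 else 0

ind≤1 : ∀ b → ind b ≤ 1
ind≤1 true  = ≤-refl
ind≤1 false = z≤n

ind-true : ∀ {b} → ind b ≡ 1 → b ≡ true
ind-true {true} _ = refl

ind-positive : ∀ {b} → 0 < ind b → b ≡ true
ind-positive {true} _ = refl

ind-≤ : ∀ {b x} → (b ≡ true → 1 ≤ x) → ind b ≤ x
ind-≤ {false} _ = z≤n
ind-≤ {true}  f = f refl

sumFin : ∀ k → (Fin k → ℕ) → ℕ
sumFin k f = sum (map f (allFin k))

sumBelow : ℕ → (ℕ → ℕ) → ℕ
sumBelow zero    h = 0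
sumBelow (suc k) h = h 0 + sumBelow k (h ∘ suc)

sumFin-suc : ∀ k (f : Fin (suc k) → ℕ) → sumFin (suc k) f ≡ f zero + sumFin k (f ∘ suc)
sumFin-suc k f = cong (λ l → f zero + sum l)
  (trans (map-tabulate suc f) (sym (map-tabulate id (f ∘ suc))))

sumFin-toℕ : ∀ k (h : ℕ → ℕ) → sumFin k (h ∘ toℕ) ≡ sumBelow k h
sumFin-toℕ zero    h = refl
sumFin-toℕ (suc k) h = trans (sumFin-suc k (h ∘ toℕ)) (cong (h 0 +_) (sumFin-toℕ k (h ∘ suc)))

sumFin-mono : ∀ k {f g : Fin k → ℕ} → (∀ i → f i ≤ g i) → sumFin k f ≤ sumFin k g
sumFin-mono zero    _  = z≤n
sumFin-mono (suc k) {f} {g} f≤g rewrite sumFin-suc k f | sumFin-suc k g =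
  +-mono-≤ (f≤g zero) (sumFin-mono k (f≤g ∘ suc))

sumFin-cong : ∀ k {f g : Fin k → ℕ} → (∀ i → f i ≡ g i) → sumFin k f ≡ sumFin k g
sumFin-cong k f≗g = ≤-antisym (sumFin-mono k (≤-reflexive ∘ f≗g)) (sumFin-mono k (≤-reflexive ∘ sym ∘ f≗g))

sumFin-+ : ∀ k (f g : Fin k → ℕ) → sumFin k (λ i → f i + g i) ≡ sumFin k f + sumFin k g
sumFin-+ zero    f g = refl
sumFin-+ (suc k) f g rewrite sumFin-suc k (λ i → f i + g i) | sumFin-suc k f | sumFin-suc k g
  | sumFin-+ k (f ∘ suc) (g ∘ suc) = interchange (f zero) (g zero) _ _
  where
  interchange : ∀ a b c d → a + b + (c + d) ≡ a + c + (b + d)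
  interchange = solve-∀

sumFin-* : ∀ k c (f : Fin k → ℕ) → sumFin k (λ i → c * f i) ≡ c * sumFin k f
sumFin-* zero    c f = sym (*-zeroʳ c)
sumFin-* (suc k) c f rewrite sumFin-suc k (λ i → c * f i) | sumFin-suc k f | sumFin-* k c (f ∘ suc) =
  sym (*-distribˡ-+ c (f zero) _)

sumFin-const : ∀ k c → sumFin k (λ _ → c) ≡ k * c
sumFin-const zero    c = refl
sumFin-const (suc k) c = trans (sumFin-suc k (λ _ → c)) (cong (c +_) (sumFin-const k c))

sumFin-swap : ∀ k l (f : Fin k → Fin l → ℕ) →
  sumFin k (λ i → sumFin l (f i)) ≡ sumFin l (λ j → sumFin k (λ i → f i j))
sumFin-swap zero    l f = sym (trans (sumFin-const l 0) (*-zeroʳ l))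
sumFin-swap (suc k) l f = begin
  sumFin (suc k) (λ i → sumFin l (f i))
    ≡⟨ sumFin-suc k (λ i → sumFin l (f i)) ⟩
  sumFin l (f zero) + sumFin k (λ i → sumFin l (f (suc i)))
    ≡⟨ cong (sumFin l (f zero) +_) (sumFin-swap k l (f ∘ suc)) ⟩
  sumFin l (f zero) + sumFin l (λ j → sumFin k (λ i → f (suc i) j))
    ≡⟨ sumFin-+ l _ _ ⟨
  sumFin l (λ j → f zero j + sumFin k (λ i → f (suc i) j))
    ≡⟨ sumFin-cong l (λ j → sumFin-suc k (λ i → f i j)) ⟨
  sumFin l (λ j → sumFin (suc k) (λ i → f i j)) ∎
  where open ≡-Reasoning

≤-sumFin : ∀ k (f : Fin k → ℕ) i → f i ≤ sumFin k f
≤-sumFin (suc k) f zero    rewrite sumFin-suc k f = m≤m+n _ _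
≤-sumFin (suc k) f (suc i) rewrite sumFin-suc k f = ≤-trans (≤-sumFin k (f ∘ suc) i) (m≤n+m _ _)

+-≤-sumFin : ∀ k (f : Fin k → ℕ) {i j} → i ≢ j → f i + f j ≤ sumFin k f
+-≤-sumFin (suc k) f {zero}  {zero}  i≢j = ⊥-elim (i≢j refl)
+-≤-sumFin (suc k) f {zero}  {suc j} _   rewrite sumFin-suc k f = +-monoʳ-≤ (f zero) (≤-sumFin k (f ∘ suc) j)
+-≤-sumFin (suc k) f {suc i} {zero}  _   rewrite sumFin-suc k f | +-comm (f (suc i)) (f zero) =
  +-monoʳ-≤ (f zero) (≤-sumFin k (f ∘ suc) i)
+-≤-sumFin (suc k) f {suc i} {suc j} i≢j rewrite sumFin-suc k f =
  ≤-trans (+-≤-sumFin k (f ∘ suc) (i≢j ∘ cong suc)) (m≤n+m _ _)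

sumBelow-++ : ∀ k l (h : ℕ → ℕ) → sumBelow (k + l) h ≡ sumBelow k h + sumBelow l (λ i → h (k + i))
sumBelow-++ zero    l h = refl
sumBelow-++ (suc k) l h = trans (cong (h 0 +_) (sumBelow-++ k l (h ∘ suc))) (sym (+-assoc (h 0) _ _))

sumBelow-mono : ∀ k {h g : ℕ → ℕ} → (∀ i → i < k → h i ≤ g i) → sumBelow k h ≤ sumBelow k g
sumBelow-mono zero    _   = z≤n
sumBelow-mono (suc k) h≤g = +-mono-≤ (h≤g 0 z<s) (sumBelow-mono k (λ i i<k → h≤g (suc i) (s≤s i<k)))

sumBelow-cong : ∀ k {h g : ℕ → ℕ} → (∀ i → h i ≡ g i) → sumBelow k h ≡ sumBelow k g
sumBelow-cong k h≗g = ≤-antisym (sumBelow-mono k (λ i _ → ≤-reflexive (h≗g i)))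
                                 (sumBelow-mono k (λ i _ → ≤-reflexive (sym (h≗g i))))

sumBelow-≤-length : ∀ {k l} (h : ℕ → ℕ) → k ≤ l → sumBelow k h ≤ sumBelow l h
sumBelow-≤-length {k} {l} h k≤l = begin
  sumBelow k h                                   ≤⟨ m≤m+n _ _ ⟩
  sumBelow k h + sumBelow (l ∸ k) (λ i → h (k + i)) ≡⟨ sumBelow-++ k (l ∸ k) h ⟨
  sumBelow (k + (l ∸ k)) h                       ≡⟨ cong (λ m → sumBelow m h) (m+[n∸m]≡n k≤l) ⟩
  sumBelow l h                                   ∎
  where open ≤-Reasoning

sumBelow-≤1 : ∀ k (h : ℕ → ℕ) → (∀ i → h i ≤ 1) → sumBelow k h ≤ k
sumBelow-≤1 zero    h _    = z≤n
sumBelow-≤1 (suc k) h h≤1 = +-mono-≤ (h≤1 0) (sumBelow-≤1 k (h ∘ suc) (h≤1 ∘ suc))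

extend : ∀ {k} → (Fin k → ℕ) → ℕ → ℕ
extend {k} f i with i <? k
... | yes i<k = f (fromℕ< i<k)
... | no  _   = 0

sumFin-extend : ∀ k (f : Fin k → ℕ) → sumFin k f ≡ sumBelow k (extend f)
sumFin-extend k f = trans (sumFin-cong k pointwise) (sumFin-toℕ k (extend f))
  where
  pointwise : ∀ i → f i ≡ extend f (toℕ i)
  pointwise i with toℕ i <? k
  ... | yes i<k = cong f (sym (fromℕ<-toℕ i i<k))
  ... | no  i≮k = ⊥-elim (i≮k (toℕ<n i))

extend-positive : ∀ {k} (f : Fin k → ℕ) i → 0 < extend f i → Σ (i < k) λ i<k → 0 < f (fromℕ< i<k)
extend-positive {k} f i pos with i <? k
... | yes i<k = i<k , pos
... | no  _   = contradiction pos (<-irrefl refl)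

extend-≤ : ∀ {k c} (f : Fin k → ℕ) → (∀ u → f u ≤ c) → ∀ i → extend f i ≤ c
extend-≤ {k} f f≤c i with i <? k
... | yes i<k = f≤c (fromℕ< i<k)
... | no  _   = z≤n

sumBelow-zero : ∀ k → sumBelow k (λ _ → 0) ≡ 0
sumBelow-zero zero    = refl
sumBelow-zero (suc k) = sumBelow-zero k

sumBelow-unique≤1 : ∀ k (h : ℕ → ℕ) → (∀ i → h i ≤ 1) →
  (∀ {i j} → i < k → j < k → h i ≡ 1 → h j ≡ 1 → i ≡ j) → sumBelow k h ≤ 1
sumBelow-unique≤1 zero    h _   _    = z≤n
sumBelow-unique≤1 (suc k) h h≤1 uniq with h 0 in h0≡ | h≤1 0
... | zero     | _ = sumBelow-unique≤1 k (h ∘ suc) (h≤1 ∘ suc)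
                       (λ i<k j<k hi hj → suc-injective (uniq (s≤s i<k) (s≤s j<k) hi hj))
... | suc zero | _ = s≤s (≤-trans (sumBelow-mono k rest≤0) (≤-reflexive (sumBelow-zero k)))
  where
  rest≤0 : ∀ i → i < k → h (suc i) ≤ 0
  rest≤0 i i<k = s≤s⁻¹ (≤∧≢⇒< (h≤1 (suc i)) (λ hi → 0≢1+n (uniq z<s (s≤s i<k) h0≡ hi)))
... | suc (suc _) | s≤s ()

sumBelow-chunks : ∀ S k (h : ℕ → ℕ) → (∀ b → b < S → sumBelow k (λ t → h (b * k + t)) ≤ 1) →
  sumBelow (S * k) h ≤ S
sumBelow-chunks zero    k h _     = z≤n
sumBelow-chunks (suc S) k h chunk = begin
  sumBelow (k + S * k) h                                   ≡⟨ sumBelow-++ k (S * k) h ⟩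
  sumBelow k h + sumBelow (S * k) (λ i → h (k + i))        ≤⟨ +-mono-≤ (chunk 0 z<s) rest ⟩
  1 + S                                                    ∎
  where
  open ≤-Reasoning
  rest : sumBelow (S * k) (λ i → h (k + i)) ≤ S
  rest = sumBelow-chunks S k (λ i → h (k + i)) λ b b<S →
    ≤-trans (≤-reflexive (sumBelow-cong k (λ t → cong h (sym (+-assoc k (b * k) t)))))
            (chunk (suc b) (s≤s b<S))

-- lo ≤ q is written lo <ᵇ suc q so that inWindow (suc lo) L (suc q) reduces to inWindow lo L q.
inWindow : ℕ → ℕ → ℕ → Bool
inWindow lo L q = (lo <ᵇ suc q) ∧ (q <ᵇ lo + L)

inWindow-intro : ∀ {lo L q} → lo ≤ q → q < lo + L → inWindow lo L q ≡ true
inWindow-intro lo≤q q<hi = ∧-true⁺ (T⇒≡true (<⇒<ᵇ (s≤s lo≤q))) (T⇒≡true (<⇒<ᵇ q<hi))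

sumBelow-window : ∀ M lo L (h : ℕ → ℕ) →
  sumBelow M (λ q → if inWindow lo L q then h q else 0) ≤ sumBelow L (λ i → h (lo + i))
sumBelow-window zero    lo       L       h = z≤n
sumBelow-window (suc M) zero     zero    h = ≤-reflexive (sumBelow-zero M)
sumBelow-window (suc M) zero     (suc L) h = +-monoʳ-≤ (h 0) (sumBelow-window M zero L (h ∘ suc))
sumBelow-window (suc M) (suc lo) L       h = sumBelow-window M lo L (h ∘ suc)

all<ᵇ : ℕ → (ℕ → Bool) → Bool
all<ᵇ zero    P = true
all<ᵇ (suc k) P = all<ᵇ k P ∧ P k

all<ᵇ-sound : ∀ {k P} → all<ᵇ k P ≡ true → ∀ {a} → a < k → P a ≡ true
all<ᵇ-sound {suc k} {P} all {a} a<k with ∧-true⁻ {all<ᵇ k P} all | m≤n⇒m<n∨m≡n (s≤s⁻¹ a<k)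
... | below , _   | inj₁ a<k′ = all<ᵇ-sound below a<k′
... | _     , Pk  | inj₂ refl = Pk

periodic : ∀ p (P : ℕ → Bool) → .{{NonZero p}} →
  (∀ a → P (p + a) ≡ P a) → all<ᵇ p P ≡ true → ∀ a → P a ≡ true
periodic p P shift base = <-rec _ step
  where
  step : ∀ a → (∀ {b} → b < a → P b ≡ true) → P a ≡ true
  step a rec with a <? p
  ... | yes a<p = all<ᵇ-sound base a<p
  ... | no  a≮p = subst (λ x → P x ≡ true) (m+[n∸m]≡n p≤a)
                    (trans (shift (a ∸ p)) (rec (∸-monoʳ-< (>-nonZero⁻¹ p) p≤a)))
    where
    p≤a : p ≤ a
    p≤a = ≮⇒≥ a≮p

least-witness : (P : ℕ → Set) → (∀ k → Dec (P k)) → ∀ R → P R →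
  Σ ℕ λ m → P m × (∀ k → k < m → ¬ P k)
least-witness P P? = <-rec _ λ R rec PR → case any? (λ (i : Fin R) → P? (toℕ i)) of λ where
  (yes (i , Pi)) → rec (toℕ<n i) Pi
  (no ¬below)    → R , PR , λ k k<R Pk → ¬below (fromℕ< k<R , subst P (sym (toℕ-fromℕ< k<R)) Pk)

greatest-witness : (P : ℕ → Set) → (∀ k → Dec (P k)) → ∀ B → (∀ k → P k → k ≤ B) → ∀ c → P c →
  Σ ℕ λ m → P m × (∀ k → P k → k ≤ m)
greatest-witness P P? B bound c Pc with P? B
... | yes PB = B , PB , bound
greatest-witness P P? zero    bound c Pc | no ¬PB = contradiction (subst P (n≤0⇒n≡0 (bound c Pc)) Pc) ¬PB
greatest-witness P P? (suc B) bound c Pc | no ¬PB = greatest-witness P P? B bound′ c Pc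
  where
  bound′ : ∀ k → P k → k ≤ B
  bound′ k Pk with m≤n⇒m<n∨m≡n (bound k Pk)
  ... | inj₁ k<1+B = s≤s⁻¹ k<1+B
  ... | inj₂ refl  = contradiction Pk ¬PB

-- Balls, counting and packings in a graph

module _ (G : Graph) where

  private
    V = Fin (n G)

  ball-edge : ∀ v r w u → ball G v r w ≡ true → Adj G w u ≡ true → ball G v (suc r) u ≡ true
  ball-edge v r w u vw wu = trans
    (cong (ball G v r u ∨_) (T⇒≡true (any⁺ (λ x → ball G v r x ∧ Adj G x u)
                                              (lose (∈-allFin w) (≡true⇒T (∧-true⁺ vw wu))))))
    (Bool.∨-zeroʳ _)

  ball-suc : ∀ v r u → ball G v r u ≡ true → ball G v (suc r) u ≡ true
  ball-suc v r u vu rewrite vu = refl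

  ball-mono : ∀ v {r s} u → r ≤ s → ball G v r u ≡ true → ball G v s u ≡ true
  ball-mono v {r} {s} u r≤s vu = subst (λ t → ball G v t u ≡ true) (m∸n+n≡m r≤s) (raise (s ∸ r))
    where
    raise : ∀ k → ball G v (k + r) u ≡ true
    raise zero    = vu
    raise (suc k) = ball-suc v (k + r) u (raise k)

  ball-centre : ∀ v → ball G v 0 v ≡ true
  ball-centre v = T⇒≡true (fromWitness {a? = v ≟ v} refl)

  ball-zero⁻ : ∀ v u → ball G v 0 u ≡ true → u ≡ v
  ball-zero⁻ v u vu = toWitness {a? = u ≟ v} (≡true⇒T vu)

  ball-suc⁻ : ∀ v r u → ball G v (suc r) u ≡ true →
    ball G v r u ≡ true ⊎ ∃[ w ] (ball G v r w ≡ true × Adj G w u ≡ true)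
  ball-suc⁻ v r u vu with ∨-true⁻ {ball G v r u} vu
  ... | inj₁ vu′  = inj₁ vu′
  ... | inj₂ step with satisfied (any⁻ (λ x → ball G v r x ∧ Adj G x u) (allFin (n G)) (≡true⇒T step))
  ...   | w , vw∧wu = inj₂ (w , ∧-true⁻ (T⇒≡true vw∧wu))

  ball-one⁺ : ∀ v u → Adj G v u ≡ true → ball G v 1 u ≡ true
  ball-one⁺ v u = ball-edge v 0 v u (ball-centre v)

  ball-one⁻ : ∀ v u → ball G v 1 u ≡ true → u ≡ v ⊎ Adj G v u ≡ true
  ball-one⁻ v u vu with ball-suc⁻ v 0 u vu
  ... | inj₁ vu₀           = inj₁ (ball-zero⁻ v u vu₀)
  ... | inj₂ (w , vw , wu) = inj₂ (subst (λ x → Adj G x u ≡ true) (ball-zero⁻ v w vw) wu)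

  ball-trans : ∀ v r w s u → ball G v r w ≡ true → ball G w s u ≡ true → ball G v (s + r) u ≡ true
  ball-trans v r w zero    u vw wu rewrite ball-zero⁻ w u wu = vw
  ball-trans v r w (suc s) u vw wu with ball-suc⁻ w s u wu
  ... | inj₁ wu′           = ball-suc v (s + r) u (ball-trans v r w s u vw wu′)
  ... | inj₂ (x , wx , xu) = ball-edge v (s + r) x u (ball-trans v r w s x vw wx) xu

  ball-sym : ∀ v r u → ball G v r u ≡ true → ball G u r v ≡ true
  ball-sym v zero    u vu rewrite ball-zero⁻ v u vu = ball-centre v
  ball-sym v (suc r) u vu with ball-suc⁻ v r u vu
  ... | inj₁ vu′           = ball-suc u r v (ball-sym v r u vu′)
  ... | inj₂ (w , vw , wu) = subst (λ t → ball G u t v ≡ true) (+-comm r 1)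
    (ball-trans u 1 w r v (ball-one⁺ u w (trans (Graph.sym G u w) wu)) (ball-sym v r w vw))

  ball-lipschitz : (h : V → ℕ) → (∀ w u → Adj G w u ≡ true → h u ≤ suc (h w)) →
    ∀ v r u → ball G v r u ≡ true → h u ≤ r + h v
  ball-lipschitz h step v zero    u vu rewrite ball-zero⁻ v u vu = ≤-refl
  ball-lipschitz h step v (suc r) u vu with ball-suc⁻ v r u vu
  ... | inj₁ vu′           = m≤n⇒m≤1+n (ball-lipschitz h step v r u vu′)
  ... | inj₂ (w , vw , wu) = ≤-trans (step w u wu) (s≤s (ball-lipschitz h step v r w vw))

  card-≤ : ∀ S → card G S ≤ n G
  card-≤ S = ≤-trans (sumFin-mono (n G) (ind≤1 ∘ S))
                     (≤-reflexive (trans (sumFin-const (n G) 1) (*-identityʳ (n G))))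

  card-cong : ∀ {S S′} → (∀ u → S u ≡ S′ u) → card G S ≡ card G S′
  card-cong S≗S′ = sumFin-cong (n G) (cong ind ∘ S≗S′)

  card-≥2 : ∀ {S u u′} → u ≢ u′ → S u ≡ true → S u′ ≡ true → 2 ≤ card G S
  card-≥2 {S} {u} {u′} u≢u′ Su Su′ =
    subst (λ x → x ≤ card G S) (cong₂ (λ a b → ind a + ind b) Su Su′) (+-≤-sumFin (n G) (ind ∘ S) u≢u′)

  card-≤2-by-candidates : ∀ {S} (P Q : ℕ → Bool) → (∀ u → S u ≡ true → P (toℕ u) ≡ true ⊎ Q (toℕ u) ≡ true) →
    (∀ {a b} → P a ≡ true → P b ≡ true → a ≡ b) → (∀ {a b} → Q a ≡ true → Q b ≡ true → a ≡ b) →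
    card G S ≤ 2
  card-≤2-by-candidates {S} P Q S⊆P∪Q P-unique Q-unique = begin
    card G S                                               ≤⟨ sumFin-mono (n G) pointwise ⟩
    sumFin (n G) (λ u → ind (P (toℕ u)) + ind (Q (toℕ u)))  ≡⟨ sumFin-+ (n G) _ _ ⟩
    sumFin (n G) (ind ∘ P ∘ toℕ) + sumFin (n G) (ind ∘ Q ∘ toℕ)
      ≡⟨ cong₂ _+_ (sumFin-toℕ (n G) (ind ∘ P)) (sumFin-toℕ (n G) (ind ∘ Q)) ⟩
    sumBelow (n G) (ind ∘ P) + sumBelow (n G) (ind ∘ Q)
      ≤⟨ +-mono-≤ (at-most-one P P-unique) (at-most-one Q Q-unique) ⟩
    2                                                      ∎
    where
    open ≤-Reasoning
    pointwise : ∀ u → ind (S u) ≤ ind (P (toℕ u)) + ind (Q (toℕ u))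
    pointwise u with S u in Su
    ... | false = z≤n
    ... | true with S⊆P∪Q u Su
    ...   | inj₁ Pu = ≤-trans (≤-reflexive (cong ind (sym Pu))) (m≤m+n _ _)
    ...   | inj₂ Qu = ≤-trans (≤-reflexive (cong ind (sym Qu))) (m≤n+m _ _)
    at-most-one : ∀ R → (∀ {a b} → R a ≡ true → R b ≡ true → a ≡ b) → sumBelow (n G) (ind ∘ R) ≤ 1
    at-most-one R R-unique = sumBelow-unique≤1 (n G) (ind ∘ R) (ind≤1 ∘ R)
      (λ _ _ Ri Rj → R-unique (ind-true Ri) (ind-true Rj))

  multipacking-unique-near : ∀ {M} → IsMultipacking G M → ∀ {w u u′} →
    ball G w 1 u ≡ true → ball G w 1 u′ ≡ true → M u ≡ true → M u′ ≡ true → u ≡ u′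
  multipacking-unique-near {M} mp {w} {u} {u′} wu wu′ Mu Mu′ with u ≟ u′
  ... | yes u≡u′ = u≡u′
  ... | no  u≢u′ = contradiction (mp w 1 ≤-refl)
                     (<⇒≱ (card-≥2 {λ x → ball G w 1 x ∧ M x} u≢u′ (∧-true⁺ wu Mu) (∧-true⁺ wu′ Mu′)))

  dominated-weight-≤-cost : (W : V → Bool) (c : ℕ) →
    (∀ v r → 0 < r → card G (λ u → ball G v r u ∧ W u) ≤ c * r) →
    ∀ f → Dominating G f → card G W ≤ c * cost G f
  dominated-weight-≤-cost W c ball-bound f dom = begin
    card G W                                       ≤⟨ sumFin-mono (n G) covered ⟩
    sumFin (n G) (λ u → sumFin (n G) (λ v → hit v u)) ≡⟨ sumFin-swap (n G) (n G) (λ u v → hit v u) ⟩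
    sumFin (n G) (λ v → sumFin (n G) (hit v))       ≤⟨ sumFin-mono (n G) per-centre ⟩
    sumFin (n G) (λ v → c * f v)                    ≡⟨ sumFin-* (n G) c f ⟩
    c * cost G f                                   ∎
    where
    open ≤-Reasoning
    hit : V → V → ℕ
    hit v u = ind ((0 <ᵇ f v) ∧ (ball G v (f v) u ∧ W u))
    covered : ∀ u → ind (W u) ≤ sumFin (n G) (λ v → hit v u)
    covered u = ind-≤ λ Wu → let (v , 0<fv , vu) = dom u in
      ≤-trans (≤-reflexive (cong ind (sym (∧-true⁺ (T⇒≡true (<⇒<ᵇ 0<fv)) (∧-true⁺ vu Wu)))))
              (≤-sumFin (n G) (λ v → hit v u) v)
    per-centre : ∀ v → sumFin (n G) (hit v) ≤ c * f v
    per-centre v with f v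
    ... | zero  = ≤-trans (≤-reflexive (trans (sumFin-const (n G) 0) (*-zeroʳ (n G)))) z≤n
    ... | suc r = ball-bound v (suc r) z<s

Searchable : Set → Set₁
Searchable A = ∀ (P : A → Set) → (∀ a → Dec (P a)) → Dec (∃ P)

searchable-Bool : Searchable Bool
searchable-Bool P P? with P? true | P? false
... | yes Pt | _      = yes (true , Pt)
... | no _   | yes Pf = yes (false , Pf)
... | no ¬Pt | no ¬Pf = no λ { (true , Pt) → ¬Pt Pt ; (false , Pf) → ¬Pf Pf }

searchable-Fin : ∀ k → Searchable (Fin k)
searchable-Fin k P P? = any? P?

searchable-functions : ∀ {A} → Searchable A → ∀ k (R : (Fin k → A) → Set) → (∀ f → Dec (R f)) →
  (∀ {f g} → (∀ i → f i ≡ g i) → R f → R g) → Dec (∃ R)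
searchable-functions search zero    R R? R-resp with R? (λ ())
... | yes Rf = yes (_ , Rf)
... | no ¬Rf = no λ (f , Rf) → ¬Rf (R-resp (λ ()) Rf)
searchable-functions search (suc k) R R? R-resp
  with search (λ a → ∃ λ f → R (a ∷ f))
         (λ a → searchable-functions search k (R ∘ (a ∷_)) (R? ∘ (a ∷_))
                  (λ f≗g → R-resp λ { zero → refl ; (suc i) → f≗g i }))
... | yes (a , f , Rf) = yes (a ∷ f , Rf)
... | no ¬∃            = no λ (f , Rf) → ¬∃ (head f , tail f , R-resp (λ { zero → refl ; (suc i) → refl }) Rf)

module _ (G : Graph) where

  private
    V = Fin (n G)

  diam-unique : ∀ {D D′} → IsDiam G D → IsDiam G D′ → D ≡ D′
  diam-unique (covers , least) (covers′ , least′) = ≤-antisym (least _ covers′) (least′ _ covers)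

  diam-pos : ∀ {D} → IsDiam G D → ∀ {u v : V} → u ≢ v → 0 < D
  diam-pos {zero}  (covers , _) u≢v = contradiction (ball-zero⁻ G _ _ (covers _ _)) u≢v
  diam-pos {suc _} _            _   = z<s

  ∃-diam : Connected G → Σ ℕ (IsDiam G)
  ∃-diam (_ , conn) with least-witness Covers covers? R covers-R
    where
    Covers : ℕ → Set
    Covers D = ∀ u v → ball G v D u ≡ true
    covers? : ∀ D → Dec (Covers D)
    covers? D = all? λ u → all? λ v → ball G v D u Bool.≟ true
    radius : V → V → ℕ
    radius u v = proj₁ (conn u v)
    R = sumFin (n G) λ u → sumFin (n G) (radius u)
    covers-R : Covers R
    covers-R u v = ball-mono G v u
      (≤-trans (≤-sumFin (n G) (radius u) v) (≤-sumFin (n G) (λ u → sumFin (n G) (radius u)) u))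
      (proj₂ (conn u v))
  ... | D , covers-D , below = D , covers-D , λ D′ covers-D′ → ≮⇒≥ λ D′<D → below D′ D′<D covers-D′

  multipacking? : ∀ M → Dec (IsMultipacking G M)
  multipacking? M = map′ from-bounded to-bounded
    (all? λ v → all? λ (r : Fin (suc (n G))) → (1 ≤? toℕ r) →-dec (packed v (toℕ r) ≤? toℕ r))
    where
    packed : V → ℕ → ℕ
    packed v r = card G (λ u → ball G v r u ∧ M u)
    from-bounded : (∀ v (r : Fin (suc (n G))) → 1 ≤ toℕ r → packed v (toℕ r) ≤ toℕ r) → IsMultipacking G M
    from-bounded bounded v r 1≤r with r ≤? n G
    ... | yes r≤n = subst (λ x → packed v x ≤ x) (toℕ-fromℕ< (s≤s r≤n))
                      (bounded v (fromℕ< (s≤s r≤n)) (subst (1 ≤_) (sym (toℕ-fromℕ< (s≤s r≤n))) 1≤r))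
    ... | no  r≰n = ≤-trans (card-≤ G _) (<⇒≤ (≰⇒> r≰n))
    to-bounded : IsMultipacking G M → ∀ v (r : Fin (suc (n G))) → 1 ≤ toℕ r → packed v (toℕ r) ≤ toℕ r
    to-bounded mp v r = mp v (toℕ r)

  multipacking-cong : ∀ {M M′} → (∀ u → M u ≡ M′ u) → IsMultipacking G M → IsMultipacking G M′
  multipacking-cong M≗M′ mp v r 1≤r =
    subst (_≤ r) (card-cong G (λ u → cong (ball G v r u ∧_) (M≗M′ u))) (mp v r 1≤r)

  ∃-multipackingNumber : Σ ℕ (IsMultipackingNumber G)
  ∃-multipackingNumber
    with greatest-witness Achievable achievable? (n G) (λ _ (M , _ , c≤M) → ≤-trans c≤M (card-≤ G M))
                          0 ((λ _ → false) , empty-packs , z≤n)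
    where
    Achievable : ℕ → Set
    Achievable c = ∃ λ M → IsMultipacking G M × c ≤ card G M
    achievable? : ∀ c → Dec (Achievable c)
    achievable? c = searchable-functions searchable-Bool (n G) _ (λ M → multipacking? M ×-dec (c ≤? card G M))
      λ M≗M′ (mp , c≤M) → multipacking-cong M≗M′ mp , subst (c ≤_) (card-cong G M≗M′) c≤M
    empty-packs : IsMultipacking G (λ _ → false)
    empty-packs v r _ = subst (_≤ r)
      (sym (trans (card-cong G (λ u → Bool.∧-zeroʳ (ball G v r u))) (trans (sumFin-const (n G) 0) (*-zeroʳ (n G)))))
      z≤n
  ... | p , (M , mp , p≤M) , maximal = p , (M , mp , ≤-antisym (maximal _ (M , mp , ≤-refl)) p≤M) ,
                                      λ M′ mp′ → maximal _ (M′ , mp′ , ≤-refl)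

  dominating? : ∀ f → Dec (Dominating G f)
  dominating? f = all? λ u → any? λ v → (0 <? f v) ×-dec (ball G v (f v) u Bool.≟ true)

  dominating-cong : ∀ {f g} → (∀ v → f v ≡ g v) → Dominating G f → Dominating G g
  dominating-cong f≗g dom u with dom u
  ... | v , 0<fv , vu = v , subst (0 <_) (f≗g v) 0<fv , subst (λ r → ball G v r u ≡ true) (f≗g v) vu

  ∃-broadcastDomNumber : ∀ {D} → IsDiam G D → 0 < D → Σ ℕ (IsBroadcastDomNumber G)
  ∃-broadcastDomNumber {D} diam 0<D
    with least-witness Affordable affordable? _ ((λ _ → fromℕ D) , everywhere-D , ≤-refl)
    where
    Affordable : ℕ → Set
    Affordable c = ∃ λ (f : V → Fin (suc D)) → Dominating G (toℕ ∘ f) × cost G (toℕ ∘ f) ≤ c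
    affordable? : ∀ c → Dec (Affordable c)
    affordable? c = searchable-functions (searchable-Fin (suc D)) (n G) _
      (λ f → dominating? (toℕ ∘ f) ×-dec (cost G (toℕ ∘ f) ≤? c))
      λ f≗g (dom , cost≤c) → dominating-cong (cong toℕ ∘ f≗g) dom ,
                             subst (_≤ c) (sumFin-cong (n G) (cong toℕ ∘ f≗g)) cost≤c
    everywhere-D : Dominating G (λ _ → toℕ (fromℕ D))
    everywhere-D u rewrite toℕ-fromℕ D = u , 0<D , proj₁ diam u u
  ... | γ , (f , dom , cost≤γ) , cheaper-fails = γ , (toℕ ∘ f , bounded-by-diam , dom , cost≡γ) , minimal
    where
    cost≡γ : cost G (toℕ ∘ f) ≡ γ
    cost≡γ = ≤-antisym cost≤γ (≮⇒≥ λ lt → cheaper-fails _ lt (f , dom , ≤-refl))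
    bounded-by-diam : IsBroadcast G (toℕ ∘ f)
    bounded-by-diam D′ diam′ v = subst (toℕ (f v) ≤_) (diam-unique diam diam′) (s≤s⁻¹ (toℕ<n (f v)))
    minimal : ∀ g → IsBroadcast G g → Dominating G g → γ ≤ cost G g
    minimal g broadcast dom-g = ≮⇒≥ λ lt →
      cheaper-fails _ lt (g′ , dominating-cong g≗g′ dom-g , ≤-reflexive (sumFin-cong (n G) (sym ∘ g≗g′)))
      where
      g′ : V → Fin (suc D)
      g′ v = fromℕ< (s≤s (broadcast D diam v))
      g≗g′ : ∀ v → g v ≡ toℕ (g′ v)
      g≗g′ v = sym (toℕ-fromℕ< (s≤s (broadcast D diam v)))

  ∃-broadcastDomNumber-connected : Connected G → ∀ {u v : V} → u ≢ v → Σ ℕ (IsBroadcastDomNumber G)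
  ∃-broadcastDomNumber-connected conn u≢v with ∃-diam conn
  ... | _ , diam = ∃-broadcastDomNumber diam (diam-pos diam u≢v)

  connected-by-index : 0 < n G → (∀ u v → toℕ v ≡ suc (toℕ u) → ball G u 2 v ≡ true) → Connected G
  connected-by-index 0<n step = 0<n , λ u v → case-split u v
    where
    forward : ∀ k u v → toℕ v ≡ toℕ u + k → ball G u (k * 2) v ≡ true
    forward zero    u v v≡u+0 rewrite toℕ-injective (trans v≡u+0 (+-identityʳ (toℕ u))) = ball-centre G u
    forward (suc k) u v v≡u+1+k = ball-trans G u (k * 2) w 2 v (forward k u w toℕ-w) (step w v v≡1+w)
      where
      w<n : toℕ u + k < n G
      w<n = ≤-trans (≤-reflexive (trans (sym (+-suc (toℕ u) k)) (sym v≡u+1+k))) (<⇒≤ (toℕ<n v))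
      w = fromℕ< w<n
      toℕ-w : toℕ w ≡ toℕ u + k
      toℕ-w = toℕ-fromℕ< w<n
      v≡1+w : toℕ v ≡ suc (toℕ w)
      v≡1+w = trans v≡u+1+k (trans (+-suc (toℕ u) k) (cong suc (sym toℕ-w)))
    case-split : ∀ u v → Σ ℕ λ r → ball G v r u ≡ true
    case-split u v with toℕ v ≤? toℕ u
    ... | yes v≤u = (toℕ u ∸ toℕ v) * 2 , forward (toℕ u ∸ toℕ v) v u (sym (m+[n∸m]≡n v≤u))
    ... | no  v≰u = (toℕ v ∸ toℕ u) * 2 ,
                    ball-sym G u ((toℕ v ∸ toℕ u) * 2) v
                      (forward (toℕ v ∸ toℕ u) u v (sym (m+[n∸m]≡n (<⇒≤ (≰⇒> v≰u)))))

-- Perfect elimination orders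

cnext^ : ∀ {k} → ℕ → Fin (suc k) → Fin (suc k)
cnext^ zero    i = i
cnext^ (suc a) i = cnext (cnext^ a i)

toℕ-cnext^ : ∀ {k} a (i : Fin (suc k)) → toℕ (cnext^ a i) ≡ (toℕ i + a) % suc k
toℕ-cnext^ {k} zero i = sym (trans (cong (_% suc k) (+-identityʳ (toℕ i))) (m<n⇒m%n≡m (toℕ<n i)))
toℕ-cnext^ {k} (suc a) i = begin
  toℕ (cnext (cnext^ a i))              ≡⟨ toℕ-fromℕ< _ ⟩
  suc (toℕ (cnext^ a i)) % N            ≡⟨ cong (λ x → suc x % N) (toℕ-cnext^ a i) ⟩
  (1 + (toℕ i + a) % N) % N             ≡⟨ %-distribˡ-+ 1 ((toℕ i + a) % N) N ⟩
  (1 % N + (toℕ i + a) % N % N) % N     ≡⟨ cong (λ x → (1 % N + x) % N) (m%n%n≡m%n (toℕ i + a) N) ⟩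
  (1 % N + (toℕ i + a) % N) % N         ≡⟨ %-distribˡ-+ 1 (toℕ i + a) N ⟨
  (1 + (toℕ i + a)) % N                 ≡⟨ cong (_% N) (sym (+-suc (toℕ i) a)) ⟩
  (toℕ i + suc a) % N                   ∎
  where
  open ≡-Reasoning
  N = suc k

cnext^-period : ∀ {k} (i : Fin (suc k)) → cnext^ (suc k) i ≡ i
cnext^-period {k} i = toℕ-injective (begin
  toℕ (cnext^ (suc k) i)  ≡⟨ toℕ-cnext^ (suc k) i ⟩
  (toℕ i + suc k) % suc k ≡⟨ [m+n]%n≡m%n (toℕ i) (suc k) ⟩
  toℕ i % suc k           ≡⟨ m<n⇒m%n≡m (toℕ<n i) ⟩
  toℕ i                   ∎)
  where open ≡-Reasoning

cnext^-≢ : ∀ {k a} (i : Fin (suc k)) → 0 < a → a < suc k → cnext^ a i ≢ i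
cnext^-≢ {k} {a} i 0<a a<N eq with toℕ i + a <? suc k
... | yes wraps-not = contradiction (+-cancelˡ-≡ (toℕ i) a 0 (begin
  toℕ i + a             ≡⟨ m<n⇒m%n≡m wraps-not ⟨
  (toℕ i + a) % suc k   ≡⟨ toℕ-cnext^ a i ⟨
  toℕ (cnext^ a i)      ≡⟨ cong toℕ eq ⟩
  toℕ i                 ≡⟨ +-identityʳ (toℕ i) ⟨
  toℕ i + 0             ∎)) (>⇒≢ 0<a)
  where open ≡-Reasoning
... | no  wraps = contradiction (+-cancelˡ-≡ (toℕ i) a (suc k) (begin
  toℕ i + a                         ≡⟨ m∸n+n≡m N≤i+a ⟨
  toℕ i + a ∸ suc k + suc k         ≡⟨ cong (_+ suc k) (begin
    toℕ i + a ∸ suc k                 ≡⟨ m<n⇒m%n≡m i+a∸N<N ⟨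
    (toℕ i + a ∸ suc k) % suc k       ≡⟨ m≤n⇒[n∸m]%m≡n%m N≤i+a ⟩
    (toℕ i + a) % suc k               ≡⟨ toℕ-cnext^ a i ⟨
    toℕ (cnext^ a i)                  ≡⟨ cong toℕ eq ⟩
    toℕ i                             ∎) ⟩
  toℕ i + suc k                     ∎)) (<⇒≢ a<N)
  where
  open ≡-Reasoning
  N≤i+a : suc k ≤ toℕ i + a
  N≤i+a = ≮⇒≥ wraps
  i+a∸N<N : toℕ i + a ∸ suc k < suc k
  i+a∸N<N = ≤-<-trans (∸-monoˡ-≤ (suc k) (+-monoʳ-≤ (toℕ i) (<⇒≤ a<N)))
            (≤-<-trans (≤-reflexive (m+n∸n≡m (toℕ i) (suc k))) (toℕ<n i))

PerfectEliminationOrder : Graph → Set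
PerfectEliminationOrder G = ∀ v w w′ → toℕ v < toℕ w → toℕ v < toℕ w′ → w ≢ w′ →
  Adj G v w ≡ true → Adj G v w′ ≡ true → Adj G w w′ ≡ true

chord-at-lowest : ∀ G → PerfectEliminationOrder G → ∀ {m} (C : Cycle G m) i →
  (∀ j → toℕ (c C i) ≤ toℕ (c C j)) → HasChord G C
chord-at-lowest G peo {m} C i lowest = p , cnext i , chord , (λ e → cnext-i≢i (trans e cnext-p)) , p≢cnext²i
  where
  -- p is the predecessor of i on the cycle; the chord joins the two cycle neighbours of i.
  p = cnext^ (3 + m) i
  cnext-p : cnext p ≡ i
  cnext-p = cnext^-period i
  cnext-i≢i : cnext i ≢ i
  cnext-i≢i = cnext^-≢ {a = 1} i z<s (s≤s z<s)
  p≢i : p ≢ i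
  p≢i = cnext^-≢ i z<s ≤-refl
  p≢cnext-i : p ≢ cnext i
  p≢cnext-i p≡cnext-i = cnext^-≢ {a = 2} i z<s (s≤s (s≤s z<s)) (trans (cong cnext (sym p≡cnext-i)) cnext-p)
  p≢cnext²i : p ≢ cnext (cnext i)
  p≢cnext²i p≡cnext²i =
    cnext^-≢ {a = 3} i z<s (s≤s (s≤s (s≤s z<s))) (trans (cong cnext (sym p≡cnext²i)) cnext-p)
  above-lowest : ∀ j → j ≢ i → toℕ (c C i) < toℕ (c C j)
  above-lowest j j≢i = ≤∧≢⇒< (lowest j) (λ e → j≢i (sym (inj C (toℕ-injective e))))
  chord : Adj G (c C p) (c C (cnext i)) ≡ true
  chord = peo (c C i) (c C p) (c C (cnext i)) (above-lowest p p≢i) (above-lowest (cnext i) cnext-i≢i)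
    (p≢cnext-i ∘′ inj C)
    (trans (Graph.sym G _ _) (subst (λ j → Adj G (c C p) (c C j) ≡ true) cnext-p (edges C p)))
    (edges C i)

peo⇒chordal : ∀ G → PerfectEliminationOrder G → Chordal G
peo⇒chordal G peo m C = chord-at-lowest G peo C (argmin position zero (allFin (4 + m)))
  (λ j → All.lookup (f[argmin]≤f[xs] {f = position} zero (allFin (4 + m))) (∈-allFin j))
  where
  position : Fin (4 + m) → ℕ
  position j = toℕ (c C j)

-- The chain of suns

mod6 : ℕ → ℕ
mod6 (suc (suc (suc (suc (suc (suc i)))))) = mod6 i
mod6 i = i

-- Vertex 6b + t is vertex t of the b-th sun: 2, 3, 4 form its triangle, the ears 0, 1, 5 are attached to
-- the sides 23, 24, 34, and ear 5 is joined to ear 0 of the next sun.  sunEdge d t says that the vertex at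
-- offset t is adjacent to the vertex d places after it.
sunEdge : ℕ → ℕ → Bool
sunEdge 1 1 = true
sunEdge 1 2 = true
sunEdge 1 3 = true
sunEdge 1 4 = true
sunEdge 1 5 = true
sunEdge 2 0 = true
sunEdge 2 2 = true
sunEdge 2 3 = true
sunEdge 3 0 = true
sunEdge 3 1 = true
sunEdge _ _ = false

sunEdge-gap : ∀ d t → sunEdge d t ≡ true → d < 4
sunEdge-gap 1 _ _ = s≤s (s≤s z≤n)
sunEdge-gap 2 _ _ = s≤s (s≤s (s≤s z≤n))
sunEdge-gap 3 _ _ = s≤s (s≤s (s≤s (s≤s z≤n)))
sunEdge-gap 0 _ ()
sunEdge-gap (suc (suc (suc (suc _)))) _ ()

linked : ℕ → ℕ → Bool
linked a b = (a <ᵇ b) ∧ sunEdge (b ∸ a) (mod6 a)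

adjacentℕ : ℕ → ℕ → Bool
adjacentℕ a b = linked a b ∨ linked b a

adjacentℕ-irrefl : ∀ a → adjacentℕ a a ≡ false
adjacentℕ-irrefl a rewrite <ᵇ-irrefl a = refl

sunChain : ℕ → Graph
sunChain S = record
  { n     = S * 6
  ; Adj   = λ u v → adjacentℕ (toℕ u) (toℕ v)
  ; sym   = λ u v → Bool.∨-comm (linked (toℕ u) (toℕ v)) (linked (toℕ v) (toℕ u))
  ; irref = λ v → adjacentℕ-irrefl (toℕ v)
  }

linked⁻ : ∀ a b → linked a b ≡ true → ∃[ d ] (b ≡ a + d × sunEdge d (mod6 a) ≡ true)
linked⁻ a b ab with ∧-true⁻ {a <ᵇ b} ab
... | a<b , edge = b ∸ a , sym (m+[n∸m]≡n (<⇒≤ (<ᵇ-true⇒< a<b))) , edge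

adjacentℕ⁻ : ∀ a b → adjacentℕ a b ≡ true →
  (∃[ d ] (b ≡ a + d × sunEdge d (mod6 a) ≡ true)) ⊎ (∃[ d ] (a ≡ b + d × sunEdge d (mod6 b) ≡ true))
adjacentℕ⁻ a b ab with ∨-true⁻ {linked a b} ab
... | inj₁ ab′ = inj₁ (linked⁻ a b ab′)
... | inj₂ ba  = inj₂ (linked⁻ b a ba)

level : ℕ → ℕ
level 0 = 0
level 1 = 1
level 2 = 1
level 3 = 1
level 4 = 1
level 5 = 2
level (suc (suc (suc (suc (suc (suc i)))))) = 3 + level i

-- Ears 0, 1, 5 of the first sun, 1, 5 of the second and 0, 1 of the third, repeated every three suns.
weighted : ℕ → Bool
weighted (suc (suc (suc (suc (suc (suc (suc (suc (suc (suc (suc (suc (suc (suc (suc (suc (suc (suc i)))))))))))))))))) = weighted i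
weighted 0  = true
weighted 1  = true
weighted 5  = true
weighted 7  = true
weighted 11 = true
weighted 12 = true
weighted 13 = true
weighted _  = false

weightedLevel : ℕ → Bool
weightedLevel (suc (suc (suc (suc (suc (suc (suc (suc (suc q))))))))) = weightedLevel q
weightedLevel 3 = false
weightedLevel 8 = false
weightedLevel _ = true

levelStep : ℕ → ℕ → Bool
levelStep a d = sunEdge d (mod6 a) ⇒ᵇ ((level (a + d) <ᵇ 2 + level a) ∧ (level a <ᵇ 2 + level (a + d)))

levelStep-ok : ∀ a → all<ᵇ 4 (levelStep a) ≡ true
levelStep-ok = periodic 6 _ (λ _ → refl) refl

peoStep : ℕ → ℕ → ℕ → Bool
peoStep a d d′ = (sunEdge d (mod6 a) ∧ sunEdge d′ (mod6 a)) ⇒ᵇ ((d ≡ᵇ d′) ∨ adjacentℕ (a + d) (a + d′))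

peoStep-ok : ∀ a → all<ᵇ 4 (λ d → all<ᵇ 4 (peoStep a d)) ≡ true
peoStep-ok = periodic 6 _ (λ _ → refl) refl

nextStep : ℕ → Bool
nextStep a = adjacentℕ a (a + 1) ∨ ((mod6 a ≡ᵇ 0) ∧ (adjacentℕ a (a + 2) ∧ adjacentℕ (a + 2) (a + 1)))

nextStep-ok : ∀ a → nextStep a ≡ true
nextStep-ok = periodic 6 _ (λ _ → refl) refl

sunEnd : ℕ → Bool
sunEnd i = i + (5 ∸ mod6 i) <ᵇ 6

sunEnd-inside : ∀ S i → i < S * 6 → i + (5 ∸ mod6 i) < S * 6
sunEnd-inside (suc S) i i<N with i <? 6
... | yes i<6 = ≤-trans (<ᵇ-true⇒< {i + (5 ∸ mod6 i)} {6} (all<ᵇ-sound {6} {sunEnd} refl i<6)) (m≤m+n 6 (S * 6))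
... | no  i≮6 = subst (λ x → x + (5 ∸ mod6 x) < 6 + S * 6) (m+[n∸m]≡n 6≤i)
                  (+-monoʳ-< 6 (sunEnd-inside S (i ∸ 6) (+-cancelˡ-< 6 (i ∸ 6) (S * 6)
                    (subst (_< 6 + S * 6) (sym (m+[n∸m]≡n 6≤i)) i<N))))
  where
  6≤i : 6 ≤ i
  6≤i = ≮⇒≥ i≮6

-- Every ear in the closed neighbourhood of x is x - 3 + earShift₁ t or x - 3 + earShift₂ t for t the offset of
-- x; nearEar states it as y + 3 = x + shift, which avoids truncated subtraction and is periodic by refl.
earShift₁ : ℕ → ℕ
earShift₁ 2 = 1
earShift₁ 3 = 0
earShift₁ 4 = 0
earShift₁ _ = 3

earShift₂ : ℕ → ℕ
earShift₂ 0 = 2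
earShift₂ 2 = 2
earShift₂ 3 = 5
earShift₂ 4 = 4
earShift₂ 5 = 4
earShift₂ _ = 3

nearEar : ℕ → ℕ → Bool
nearEar x y = (y + 3 ≡ᵇ x + earShift₁ (mod6 x)) ∨ (y + 3 ≡ᵇ x + earShift₂ (mod6 x))

nearForward nearBackward : ℕ → ℕ → Bool
nearForward a d = (weighted (a + d) ∧ ((d ≡ᵇ 0) ∨ sunEdge d (mod6 a))) ⇒ᵇ nearEar a (a + d)
nearBackward a d = (weighted a ∧ sunEdge d (mod6 a)) ⇒ᵇ nearEar (a + d) a

nearForward-ok : ∀ a → all<ᵇ 4 (nearForward a) ≡ true
nearForward-ok = periodic 18 _ (λ _ → refl) refl

nearBackward-ok : ∀ a → all<ᵇ 4 (nearBackward a) ≡ true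
nearBackward-ok = periodic 18 _ (λ _ → refl) refl

fiveLevels : ℕ → Bool
fiveLevels lo = sumBelow 5 (λ i → ind (weightedLevel (lo + i))) ≤ᵇ 4

fiveLevels-ok : ∀ lo → fiveLevels lo ≡ true
fiveLevels-ok = periodic 9 _ (λ _ → refl) refl

-- Vertex 2 is adjacent to every vertex of its sun but 5, vertex 3 to all but 1, vertex 4 to all but 0.
hub : ℕ → ℕ → ℕ
hub t t′ = if (t ≡ᵇ 5) ∨ (t′ ≡ᵇ 5) then (if (t ≡ᵇ 1) ∨ (t′ ≡ᵇ 1) then 4 else 3) else 2

closeTo : ℕ → ℕ → Bool
closeTo x y = (x ≡ᵇ y) ∨ adjacentℕ x y

hubCovers : ℕ → ℕ → ℕ → Bool
hubCovers b t t′ = closeTo (b * 6 + hub t t′) (b * 6 + t) ∧ closeTo (b * 6 + hub t t′) (b * 6 + t′)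

hubCovers-ok : ∀ b → all<ᵇ 6 (λ t → all<ᵇ 6 (hubCovers b t)) ≡ true
hubCovers-ok = periodic 1 _ (λ _ → refl) refl

hub-close : ∀ b {t t′} → t < 6 → t′ < 6 →
  closeTo (b * 6 + hub t t′) (b * 6 + t) ≡ true × closeTo (b * 6 + hub t t′) (b * 6 + t′) ≡ true
hub-close b {t} {t′} t<6 t′<6 = ∧-true⁻ {closeTo (b * 6 + hub t t′) (b * 6 + t)}
  (all<ᵇ-sound {6} {hubCovers b t} (all<ᵇ-sound {6} {λ t → all<ᵇ 6 (hubCovers b t)} (hubCovers-ok b) t<6) t′<6)

hub≤4 : ∀ t t′ → hub t t′ ≤ 4
hub≤4 t t′ with (t ≡ᵇ 5) ∨ (t′ ≡ᵇ 5)
... | false = s≤s (s≤s z≤n)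
... | true with (t ≡ᵇ 1) ∨ (t′ ≡ᵇ 1)
...   | true  = ≤-refl
...   | false = s≤s (s≤s (s≤s z≤n))

weight-total : ∀ K → sumBelow (K * 18) (ind ∘ weighted) ≡ K * 7
weight-total zero    = refl
weight-total (suc K) = trans (sumBelow-++ 18 (K * 18) (ind ∘ weighted)) (cong (7 +_) (weight-total K))

weighted-level-reindex : ∀ K (W : ℕ → ℕ) →
  sumBelow (K * 18) (λ i → if weighted i then W (level i) else 0)
    ≡ sumBelow (K * 9) (λ q → if weightedLevel q then W q else 0)
weighted-level-reindex zero    W = refl
weighted-level-reindex (suc K) W = begin
  sumBelow (18 + K * 18) (by-vertex W)                          ≡⟨ sumBelow-++ 18 (K * 18) (by-vertex W) ⟩
  sumBelow 18 (by-vertex W) + sumBelow (K * 18) (by-vertex W′)  ≡⟨ cong (sumBelow 9 (by-level W) +_)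
                                                                         (weighted-level-reindex K W′) ⟩
  sumBelow 9 (by-level W) + sumBelow (K * 9) (by-level W′)      ≡⟨ sumBelow-++ 9 (K * 9) (by-level W) ⟨
  sumBelow (9 + K * 9) (by-level W)                             ∎
  where
  open ≡-Reasoning
  W′ : ℕ → ℕ
  W′ q = W (9 + q)
  by-vertex by-level : (ℕ → ℕ) → ℕ → ℕ
  by-vertex W i = if weighted i then W (level i) else 0
  by-level W q = if weightedLevel q then W q else 0

level-step : ∀ a d → sunEdge d (mod6 a) ≡ true → level (a + d) ≤ suc (level a) × level a ≤ suc (level (a + d))
level-step a d edge with ∧-true⁻ {level (a + d) <ᵇ 2 + level a} (⇒ᵇ-mp {sunEdge d (mod6 a)}
                           (all<ᵇ-sound {4} {levelStep a} (levelStep-ok a) (sunEdge-gap d (mod6 a) edge)) edge)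
... | up , down = s≤s⁻¹ (<ᵇ-true⇒< up) , s≤s⁻¹ (<ᵇ-true⇒< down)

level-lipschitz : ∀ a b → adjacentℕ a b ≡ true → level b ≤ suc (level a)
level-lipschitz a b ab with adjacentℕ⁻ a b ab
... | inj₁ (d , refl , edge) = proj₁ (level-step a d edge)
... | inj₂ (d , refl , edge) = proj₂ (level-step b d edge)

peo-step : ∀ a d d′ → sunEdge d (mod6 a) ≡ true → sunEdge d′ (mod6 a) ≡ true →
  d ≡ d′ ⊎ adjacentℕ (a + d) (a + d′) ≡ true
peo-step a d d′ e e′ with ∨-true⁻ {d ≡ᵇ d′} (⇒ᵇ-mp {sunEdge d (mod6 a) ∧ sunEdge d′ (mod6 a)}
                         (all<ᵇ-sound {4} {peoStep a d}
                            (all<ᵇ-sound {4} {λ d → all<ᵇ 4 (peoStep a d)} (peoStep-ok a) (sunEdge-gap d _ e))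
                            (sunEdge-gap d′ _ e′))
                         (∧-true⁺ e e′))
... | inj₁ d≡d′ = inj₁ (≡ᵇ-true⇒≡ d≡d′)
... | inj₂ adj  = inj₂ adj

nearEar-covers-weighted : ∀ x y → y ≡ x ⊎ adjacentℕ x y ≡ true → weighted y ≡ true → nearEar x y ≡ true
nearEar-covers-weighted x .x (inj₁ refl) wx = subst (λ y → nearEar x y ≡ true) (+-identityʳ x)
  (⇒ᵇ-mp (all<ᵇ-sound {4} {nearForward x} (nearForward-ok x) z<s)
         (∧-true⁺ (subst (λ y → weighted y ≡ true) (sym (+-identityʳ x)) wx) refl))
nearEar-covers-weighted x y (inj₂ xy) wy with adjacentℕ⁻ x y xy
... | inj₁ (d , refl , e) = ⇒ᵇ-mp (all<ᵇ-sound {4} {nearForward x} (nearForward-ok x) (sunEdge-gap d _ e))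
                                  (∧-true⁺ wy (trans (cong ((d ≡ᵇ 0) ∨_) e) (Bool.∨-zeroʳ _)))
... | inj₂ (d , refl , e) = ⇒ᵇ-mp (all<ᵇ-sound {4} {nearBackward y} (nearBackward-ok y) (sunEdge-gap d _ e))
                                  (∧-true⁺ wy e)

+3-≡ᵇ-unique : ∀ c {a b} → (a + 3 ≡ᵇ c) ≡ true → (b + 3 ≡ᵇ c) ≡ true → a ≡ b
+3-≡ᵇ-unique c {a} {b} ha hb = +-cancelʳ-≡ 3 a b (trans (≡ᵇ-true⇒≡ ha) (sym (≡ᵇ-true⇒≡ hb)))

weightedLevel-window : ∀ lo L → 5 ≤ L → sumBelow L (λ i → ind (weightedLevel (lo + i))) ≤ L ∸ 1
weightedLevel-window lo L 5≤L = begin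
  sumBelow L h                                          ≡⟨ cong (λ k → sumBelow k h) (sym (m+[n∸m]≡n 5≤L)) ⟩
  sumBelow (5 + (L ∸ 5)) h                              ≡⟨ sumBelow-++ 5 (L ∸ 5) h ⟩
  sumBelow 5 h + sumBelow (L ∸ 5) (λ i → h (5 + i))     ≤⟨ +-mono-≤ (≤ᵇ-true⇒≤ {sumBelow 5 h} (fiveLevels-ok lo))
                                                                    (sumBelow-≤1 (L ∸ 5) _ (λ i → ind≤1 _)) ⟩
  4 + (L ∸ 5)                                           ≡⟨ +-∸-assoc 4 5≤L ⟨
  L ∸ 1                                                 ∎
  where
  open ≤-Reasoning
  h : ℕ → ℕ
  h i = ind (weightedLevel (lo + i))

module _ (S : ℕ) where

  private
    G = sunChain S
    V = Fin (S * 6)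

  Adj-at : ∀ {a b} (u v : V) → toℕ u ≡ a → toℕ v ≡ b → adjacentℕ a b ≡ true → Adj G u v ≡ true
  Adj-at u v refl refl ab = ab

  sunChain-peo : PerfectEliminationOrder G
  sunChain-peo v w w′ v<w v<w′ w≢w′ vw vw′
    with adjacentℕ⁻ (toℕ v) (toℕ w) vw | adjacentℕ⁻ (toℕ v) (toℕ w′) vw′
  ... | inj₂ (d , v≡w+d , _) | _ =
    contradiction (≤-trans (m≤m+n _ d) (≤-reflexive (sym v≡w+d))) (<⇒≱ v<w)
  ... | inj₁ _ | inj₂ (d , v≡w′+d , _) =
    contradiction (≤-trans (m≤m+n _ d) (≤-reflexive (sym v≡w′+d))) (<⇒≱ v<w′)
  ... | inj₁ (d , w≡v+d , e) | inj₁ (d′ , w′≡v+d′ , e′) with peo-step (toℕ v) d d′ e e′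
  ...   | inj₁ d≡d′ = contradiction (toℕ-injective (trans w≡v+d (trans (cong (toℕ v +_) d≡d′) (sym w′≡v+d′)))) w≢w′
  ...   | inj₂ adj  = Adj-at w w′ w≡v+d w′≡v+d′ adj

  next-within-two : ∀ u v → toℕ v ≡ suc (toℕ u) → ball G u 2 v ≡ true
  next-within-two u v v≡1+u with ∨-true⁻ {adjacentℕ (toℕ u) (toℕ u + 1)} (nextStep-ok (toℕ u))
  ... | inj₁ adj = ball-suc G u 1 v (ball-one⁺ G u v (Adj-at u v refl v≡u+1 adj))
    where
    v≡u+1 : toℕ v ≡ toℕ u + 1
    v≡u+1 = trans v≡1+u (+-comm 1 (toℕ u))
  ... | inj₂ via-2 with ∧-true⁻ {mod6 (toℕ u) ≡ᵇ 0} via-2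
  ...   | offset0 , uw∧wv with ∧-true⁻ {adjacentℕ (toℕ u) (toℕ u + 2)} uw∧wv
  ...     | uw , wv = ball-edge G u 1 w v (ball-one⁺ G u w (Adj-at u w refl toℕ-w uw)) (Adj-at w v toℕ-w v≡u+1 wv)
    where
    v≡u+1 : toℕ v ≡ toℕ u + 1
    v≡u+1 = trans v≡1+u (+-comm 1 (toℕ u))
    w<N : toℕ u + 2 < S * 6
    w<N = ≤-<-trans (+-monoʳ-≤ (toℕ u) {2} {5} (s≤s (s≤s z≤n)))
      (subst (λ t → toℕ u + (5 ∸ t) < S * 6) (≡ᵇ-true⇒≡ {mod6 (toℕ u)} {0} offset0)
             (sunEnd-inside S (toℕ u) (toℕ<n u)))
    w = fromℕ< w<N
    toℕ-w : toℕ w ≡ toℕ u + 2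
    toℕ-w = toℕ-fromℕ< w<N

  sunChain-connected : 0 < S → Connected G
  sunChain-connected 0<S = connected-by-index G (≤-trans 0<S (m≤m*n S 6)) next-within-two

  weighted-in-ball₁ : ∀ v → card G (λ u → ball G v 1 u ∧ weighted (toℕ u)) ≤ 2
  weighted-in-ball₁ v = card-≤2-by-candidates G (λ y → y + 3 ≡ᵇ c₁) (λ y → y + 3 ≡ᵇ c₂) covered
    (+3-≡ᵇ-unique c₁) (+3-≡ᵇ-unique c₂)
    where
    c₁ = toℕ v + earShift₁ (mod6 (toℕ v))
    c₂ = toℕ v + earShift₂ (mod6 (toℕ v))
    covered : ∀ u → ball G v 1 u ∧ weighted (toℕ u) ≡ true → (toℕ u + 3 ≡ᵇ c₁) ≡ true ⊎ (toℕ u + 3 ≡ᵇ c₂) ≡ true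
    covered u vu∧wu with ∧-true⁻ {ball G v 1 u} vu∧wu
    ... | vu , wu =
      ∨-true⁻ (nearEar-covers-weighted (toℕ v) (toℕ u) (Sum.map (cong toℕ) id (ball-one⁻ G v u vu)) wu)

  ball-level : ∀ v r u → ball G v r u ≡ true →
    level (toℕ u) ≤ r + level (toℕ v) × level (toℕ v) ≤ r + level (toℕ u)
  ball-level v r u vu = lipschitz v r u vu , lipschitz u r v (ball-sym G v r u vu)
    where
    lipschitz = ball-lipschitz G (level ∘ toℕ) (λ w u → level-lipschitz (toℕ w) (toℕ u))

  ball-in-level-window : ∀ v r u → ball G v r u ≡ true →
    inWindow (level (toℕ v) ∸ r) (suc (2 * r)) (level (toℕ u)) ≡ true
  ball-in-level-window v r u vu with ball-level v r u vu
  ... | up , down = inWindow-intro lo≤u u<hi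
    where
    open ≤-Reasoning
    lo = level (toℕ v) ∸ r
    lo≤u : lo ≤ level (toℕ u)
    lo≤u = ≤-trans (∸-monoˡ-≤ r down) (≤-reflexive (m+n∸m≡n r (level (toℕ u))))
    reorder : ∀ r lo → r + (r + lo) ≡ lo + 2 * r
    reorder = solve-∀
    u<hi : level (toℕ u) < lo + suc (2 * r)
    u<hi = begin-strict
      level (toℕ u)     ≤⟨ up ⟩
      r + level (toℕ v) ≤⟨ +-monoʳ-≤ r (m≤n+m∸n (level (toℕ v)) r) ⟩
      r + (r + lo)      ≡⟨ reorder r lo ⟩
      lo + 2 * r        <⟨ +-monoʳ-< lo ≤-refl ⟩
      lo + suc (2 * r)  ∎

  weighted-in-wide-ball : ∀ v r → 2 ≤ r → card G (λ u → ball G v r u ∧ weighted (toℕ u)) ≤ 2 * r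
  weighted-in-wide-ball v r 2≤r = begin
    card G (λ u → ball G v r u ∧ weighted (toℕ u))                    ≤⟨ sumFin-mono (S * 6) pointwise ⟩
    sumFin (S * 6) (g ∘ toℕ)                                           ≡⟨ sumFin-toℕ (S * 6) g ⟩
    sumBelow (S * 6) g                                                 ≤⟨ sumBelow-≤-length g (*-monoʳ-≤ S (6≤18)) ⟩
    sumBelow (S * 18) g                                                ≡⟨ weighted-level-reindex S (ind ∘ inWindow lo L) ⟩
    sumBelow (S * 9) (λ q → if weightedLevel q then ind (inWindow lo L q) else 0)
      ≡⟨ sumBelow-cong (S * 9) (λ q → if-ind-swap (weightedLevel q) (inWindow lo L q)) ⟩
    sumBelow (S * 9) (λ q → if inWindow lo L q then ind (weightedLevel q) else 0)
      ≤⟨ sumBelow-window (S * 9) lo L (ind ∘ weightedLevel) ⟩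
    sumBelow L (λ i → ind (weightedLevel (lo + i)))
      ≤⟨ weightedLevel-window lo L (s≤s (*-monoʳ-≤ 2 2≤r)) ⟩
    2 * r                                                             ∎
    where
    open ≤-Reasoning
    6≤18 : 6 ≤ 18
    6≤18 = m≤m+n 6 12
    lo = level (toℕ v) ∸ r
    L = suc (2 * r)
    g : ℕ → ℕ
    g i = if weighted i then ind (inWindow lo L (level i)) else 0
    if-ind-swap : ∀ a b → (if a then ind b else 0) ≡ (if b then ind a else 0)
    if-ind-swap false false = refl
    if-ind-swap false true  = refl
    if-ind-swap true  false = refl
    if-ind-swap true  true  = refl
    pointwise : ∀ u → ind (ball G v r u ∧ weighted (toℕ u)) ≤ g (toℕ u)
    pointwise u = ind-≤ λ vu∧wu → let (vu , wu) = ∧-true⁻ {ball G v r u} vu∧wu in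
      ≤-reflexive (sym (trans (cong (λ b → if b then ind (inWindow lo L (level (toℕ u))) else 0) wu)
                              (cong ind (ball-in-level-window v r u vu))))

  weighted-in-ball : ∀ v r → 0 < r → card G (λ u → ball G v r u ∧ weighted (toℕ u)) ≤ 2 * r
  weighted-in-ball v 0             ()
  weighted-in-ball v 1             _ = weighted-in-ball₁ v
  weighted-in-ball v (suc (suc r)) _ = weighted-in-wide-ball v (2 + r) (s≤s (s≤s z≤n))

  vertex : ∀ {x} → x < S * 6 → V
  vertex x<N = fromℕ< x<N

  closeTo⇒ball₁ : ∀ {x y} (x<N : x < S * 6) (y<N : y < S * 6) → closeTo x y ≡ true →
    ball G (vertex x<N) 1 (vertex y<N) ≡ true
  closeTo⇒ball₁ {x} {y} x<N y<N xy with ∨-true⁻ {x ≡ᵇ y} xy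
  ... | inj₁ x≡y rewrite ≡ᵇ-true⇒≡ {x} {y} x≡y = ball-suc G _ 0 _ (ball-centre G (vertex x<N))
  ... | inj₂ adj = ball-one⁺ G _ _ (Adj-at _ _ (toℕ-fromℕ< x<N) (toℕ-fromℕ< y<N) adj)

  multipacking-one-per-sun : ∀ {M} → IsMultipacking G M → ∀ b → b < S →
    sumBelow 6 (λ t → extend (ind ∘ M) (b * 6 + t)) ≤ 1
  multipacking-one-per-sun {M} mp b b<S =
    sumBelow-unique≤1 6 _ (λ t → extend-≤ (ind ∘ M) (ind≤1 ∘ M) (b * 6 + t)) same-offset
    where
    sun-inside : ∀ {t} → t < 6 → b * 6 + t < S * 6
    sun-inside t<6 = <-≤-trans (+-monoʳ-< (b * 6) t<6) (≤-trans (≤-reflexive (+-comm (b * 6) 6)) (*-monoˡ-≤ 6 b<S))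
    same-offset : ∀ {t t′} → t < 6 → t′ < 6 →
      extend (ind ∘ M) (b * 6 + t) ≡ 1 → extend (ind ∘ M) (b * 6 + t′) ≡ 1 → t ≡ t′
    same-offset {t} {t′} t<6 t′<6 Mt Mt′
      with extend-positive (ind ∘ M) _ (≤-reflexive (sym Mt)) | extend-positive (ind ∘ M) _ (≤-reflexive (sym Mt′))
    ... | u<N , Mu | u′<N , Mu′ = +-cancelˡ-≡ (b * 6) t t′ (begin
      b * 6 + t             ≡⟨ toℕ-fromℕ< u<N ⟨
      toℕ (vertex u<N)      ≡⟨ cong toℕ (multipacking-unique-near G mp (closeTo⇒ball₁ hub<N u<N hub-t)
                                 (closeTo⇒ball₁ hub<N u′<N hub-t′) (ind-positive Mu) (ind-positive Mu′)) ⟩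
      toℕ (vertex u′<N)     ≡⟨ toℕ-fromℕ< u′<N ⟩
      b * 6 + t′            ∎)
      where
      open ≡-Reasoning
      hub<N : b * 6 + hub t t′ < S * 6
      hub<N = sun-inside (s≤s (≤-trans (hub≤4 t t′) (n≤1+n 4)))
      hub-t = proj₁ (hub-close b t<6 t′<6)
      hub-t′ = proj₂ (hub-close b t<6 t′<6)

  multipacking-≤-suns : ∀ M → IsMultipacking G M → card G M ≤ S
  multipacking-≤-suns M mp = begin
    card G M                            ≡⟨ sumFin-extend (S * 6) (ind ∘ M) ⟩
    sumBelow (S * 6) (extend (ind ∘ M)) ≤⟨ sumBelow-chunks S 6 _ (multipacking-one-per-sun mp) ⟩
    S                                   ∎
    where open ≤-Reasoning

weighted-card : ∀ K → card (sunChain (K * 3)) (weighted ∘ toℕ) ≡ K * 7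
weighted-card K = begin
  sumFin (K * 3 * 6) (ind ∘ weighted ∘ toℕ) ≡⟨ sumFin-toℕ (K * 3 * 6) (ind ∘ weighted) ⟩
  sumBelow (K * 3 * 6) (ind ∘ weighted)     ≡⟨ cong (λ m → sumBelow m (ind ∘ weighted)) (*-assoc K 3 6) ⟩
  sumBelow (K * 18) (ind ∘ weighted)        ≡⟨ weight-total K ⟩
  K * 7                                     ∎
  where open ≡-Reasoning

broadcast-cost-≥ : ∀ K f → Dominating (sunChain (K * 3)) f → K * 7 ≤ 2 * cost (sunChain (K * 3)) f
broadcast-cost-≥ K f dom = subst (_≤ 2 * cost (sunChain (K * 3)) f) (weighted-card K)
  (dominated-weight-≤-cost (sunChain (K * 3)) (weighted ∘ toℕ) 2 (weighted-in-ball (K * 3)) f dom)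

gap-from-bounds : ∀ N p γ → p ≤ suc N * 2 * 3 → suc N * 2 * 7 ≤ 2 * γ → p + N ≤ γ
gap-from-bounds N p γ p≤ γ≥ = begin
  p + N                 ≤⟨ +-monoˡ-≤ N p≤ ⟩
  suc N * 2 * 3 + N     ≤⟨ +-monoʳ-≤ (suc N * 2 * 3) (n≤1+n N) ⟩
  suc N * 2 * 3 + suc N ≡⟨ six-plus-one N ⟩
  suc N * 7             ≤⟨ *-cancelˡ-≤ 2 (≤-trans (≤-reflexive (double N)) γ≥) ⟩
  γ                     ∎
  where
  open ≤-Reasoning
  six-plus-one : ∀ N → suc N * 2 * 3 + suc N ≡ suc N * 7
  six-plus-one = solve-∀
  double : ∀ N → 2 * (suc N * 7) ≡ suc N * 2 * 7
  double = solve-∀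

multipackingNumber-≤-suns : ∀ S {p} → IsMultipackingNumber (sunChain S) p → p ≤ S
multipackingNumber-≤-suns S ((M , mp , card≡p) , _) = subst (_≤ S) card≡p (multipacking-≤-suns S M mp)

broadcastDomNumber-≥ : ∀ K {γ} → IsBroadcastDomNumber (sunChain (K * 3)) γ → K * 7 ≤ 2 * γ
broadcastDomNumber-≥ K ((f , _ , dom , cost≡γ) , _) =
  subst (λ c → K * 7 ≤ 2 * c) cost≡γ (broadcast-cost-≥ K f dom)

sunChain-gap : ∀ N γ p → IsBroadcastDomNumber (sunChain (suc N * 2 * 3)) γ →
  IsMultipackingNumber (sunChain (suc N * 2 * 3)) p → p + N ≤ γ
sunChain-gap N γ p γ-spec p-spec = gap-from-bounds N p γ
  (multipackingNumber-≤-suns (suc N * 2 * 3) p-spec) (broadcastDomNumber-≥ (suc N * 2) γ-spec)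

-- γ and p are given to sunChain-gap explicitly: recovering them by unification would run the searches.
corollary1 : ∀ (N : ℕ) → ∃[ G ] (Connected G × Chordal G
    × ∃[ g ] ∃[ p ] (IsBroadcastDomNumber G g × IsMultipackingNumber G p × p + N ≤ g))
corollary1 N =
  let S         = suc N * 2 * 3
      G         = sunChain S
      connected = sunChain-connected S z<s
      γ         = ∃-broadcastDomNumber-connected G connected {zero} {suc zero} (λ ())
      p         = ∃-multipackingNumber G
  in G , connected , peo⇒chordal G (sunChain-peo S) ,
     proj₁ γ , proj₁ p , proj₂ γ , proj₂ p , sunChain-gap N (proj₁ γ) (proj₁ p) (proj₂ γ) (proj₂ p)
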